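{- Let a graph $G$ of order $n$ be factored into a connected graph $H$ and a graph $K$ with no isolated vertex. Then: (i) if $H$ is non-bipartite, then $G$ is connected; (ii) if $H$ is bipartite and $G$ is not connected, then $K$ is a regular bipartite graph and consequently $n$ is even; moreover, $G$ is a disjoint union of two non-bipartite connected graphs.
   Context: All graphs are finite and simple. A graph $G$ is factored into graphs $H$ and $K$ (all on $n$ vertices) if there exist adjacency matrices $A,B,C$ of $G,H,K$ respectively (symmetric $n\times n$ $(0,1)$-matrices with zero diagonal, for some vertex orderings) with $A=BC$; the three graphs are then regarded as having the common vertex set $\{1,\dots,n\}$. -}

module Defs where

open import Data.Nat using (ℕ; zero; suc; _+_; _*_)
open import Data.Nat.Divisibility using (_∣_)
open import Data.Fin using (Fin; zero; suc)
open import Data.Bool using (Bool; true; false)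
open import Data.Product using (Σ; ∃; _×_; _,_)
open import Data.Sum using (_⊎_)
open import Relation.Binary.PropositionalEquality using (_≡_; _≢_)
open import Relation.Nullary using (¬_)
open import Data.Unit using (⊤)

Mat : ℕ → Set
Mat n = Fin n → Fin n → ℕ

∑ : {n : ℕ} → (Fin n → ℕ) → ℕ
∑ {zero}  f = 0
∑ {suc n} f = f zero + ∑ (λ i → f (suc i))

_·_ : {n : ℕ} → Mat n → Mat n → Mat n
(B · C) i j = ∑ (λ k → B i k * C k j)

record IsAdjacency {n : ℕ} (M : Mat n) : Set where
  field
    zero-one  : ∀ i j → M i j ≡ 0 ⊎ M i j ≡ 1
    symmetric : ∀ i j → M i j ≡ M j i
    diag-zero : ∀ i → M i i ≡ 0

Adj : {n : ℕ} → Mat n → Fin n → Fin n → Set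
Adj M i j = M i j ≡ 1

data WalkIn {n : ℕ} (M : Mat n) (P : Fin n → Set) : Fin n → Fin n → Set where
  here : ∀ {i} → P i → WalkIn M P i i
  step : ∀ {i j k} → P i → Adj M i j → WalkIn M P j k → WalkIn M P i k

All : {n : ℕ} → Fin n → Set
All _ = ⊤

Connected : {n : ℕ} → Mat n → Set
Connected {n} M = ∀ (i j : Fin n) → WalkIn M All i j

Bipartite : {n : ℕ} → Mat n → Set
Bipartite {n} M = Σ (Fin n → Bool) λ c → ∀ i j → Adj M i j → c i ≢ c j

degree : {n : ℕ} → Mat n → Fin n → ℕ
degree M i = ∑ (M i)

Regular : {n : ℕ} → Mat n → Set
Regular {n} M = ∃ λ r → ∀ (i : Fin n) → degree M i ≡ r

NoIsolatedVertex : {n : ℕ} → Mat n → Set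
NoIsolatedVertex {n} M = ∀ (i : Fin n) → ∃ λ j → Adj M i j

Even : ℕ → Set
Even n = 2 ∣ n

ConnectedOn : {n : ℕ} → Mat n → (Fin n → Set) → Set
ConnectedOn {n} M P =
  (∃ λ (i : Fin n) → P i) × (∀ i j → P i → P j → WalkIn M P i j)

BipartiteOn : {n : ℕ} → Mat n → (Fin n → Set) → Set
BipartiteOn {n} M P =
  Σ (Fin n → Bool) λ c → ∀ i j → P i → P j → Adj M i j → c i ≢ c j

DisjointUnionOfTwoConnNonBip : {n : ℕ} → Mat n → Set
DisjointUnionOfTwoConnNonBip {n} M =
  Σ (Fin n → Bool) λ s →
    (∀ i j → s i ≢ s j → ¬ Adj M i j)
    × ConnectedOn M (λ i → s i ≡ true)
    × ¬ BipartiteOn M (λ i → s i ≡ true)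
    × ConnectedOn M (λ i → s i ≡ false)
    × ¬ BipartiteOn M (λ i → s i ≡ false)

module Submission where

-- G, H, K are the graphs of A, B, C. As A = BC has entries ≤ 1 and A = Aᵀ = CB, an H-edge i a
-- followed by a K-edge a j is a G-edge i j, and so is a K-edge followed by an H-edge. Hence every
-- even walk i – a – k of H lifts to the walk i – j – k of G, j any K-neighbour of a. If H is not
-- bipartite, any two vertices are joined by an even walk of H, so G is connected. If H is
-- bipartite with classes X, Y, a K-edge inside a class or a G-edge between the classes would make
-- G connected as well; so when G is disconnected, K is bipartite with the same classes and G is
-- the disjoint union of G[X] and G[Y], each connected by lifted even walks. A proper colouring of
-- G[X] is constant along lifted even walks, hence on X, yet X contains a G-edge.
-- K is regular: CA = CBC is symmetric, and for an H-edge i k every K-neighbour j of k is a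
-- G-neighbour of i, so deg k ≤ (CA) k i = (CA) i k ≤ deg i. Counting the edges of the r-regular
-- bipartite K from both sides gives r |X| = r |Y|, so n = 2 |X|.

open import Defs
open import Data.Bool using (Bool; true; false; not; _xor_)
open import Data.Bool.Properties
  using (_≟_; ¬-not; not-¬; not-distribˡ-xor; not-distribʳ-xor; xor-annihilates-not)
open import Data.Empty using (⊥-elim)
open import Data.Fin using (Fin; zero; suc)
open import Data.Fin.Properties using (any?)
open import Data.Nat using (ℕ; zero; suc; _+_; _*_; _≤_; z≤n; NonZero; >-nonZero)
open import Data.Nat.Divisibility using (divides)
open import Data.Nat.Properties
  using (+-*-semiring; ≤-refl; ≤-trans; ≤-antisym; +-mono-≤; m≤m+n; m≤n+m; *-zeroʳ; *-identityʳ;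
         *-cancelʳ-≡; *-comm; *-monoʳ-≤; +-identityʳ; 0≢1+n; module ≤-Reasoning)
  renaming (_≟_ to _≟ℕ_)
open import Algebra.Properties.Semiring.Sum +-*-semiring
  using (sum; sum-cong-≗; ∑-comm; ∑-distrib-+; *-distribˡ-sum; *-distribʳ-sum)
open import Data.Nat.Tactic.RingSolver using (solve-∀)
open import Data.Product using (∃; ∃₂; _×_; _,_; proj₁; proj₂)
open import Data.Sum using (inj₁; inj₂)
open import Data.Unit using (tt)
open import Relation.Binary.PropositionalEquality
open import Relation.Nullary using (¬_; yes; no)
open import Relation.Nullary.Decidable using (_×-dec_; decidable-stable)

private
  variable
    n : ℕ
    M : Mat n
    P : Fin n → Set
    i j k : Fin n
    p q : Bool

∑≗sum : (f : Fin n → ℕ) → ∑ f ≡ sum f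
∑≗sum {zero}  f = refl
∑≗sum {suc n} f = cong (f zero +_) (∑≗sum (λ i → f (suc i)))

sum-mono-≤ : {f g : Fin n → ℕ} → (∀ i → f i ≤ g i) → sum f ≤ sum g
sum-mono-≤ {zero}  f≤g = z≤n
sum-mono-≤ {suc n} f≤g = +-mono-≤ (f≤g zero) (sum-mono-≤ (λ i → f≤g (suc i)))

≤-sum : (f : Fin n → ℕ) (i : Fin n) → f i ≤ sum f
≤-sum f zero    = m≤m+n _ _
≤-sum f (suc i) = ≤-trans (≤-sum (λ i → f (suc i)) i) (m≤n+m _ _)

sum-ones : sum {n} (λ _ → 1) ≡ n
sum-ones {zero}  = refl
sum-ones {suc n} = cong suc (sum-ones {n})

≢-≢⇒≡ : {x y z : Bool} → x ≢ y → y ≢ z → x ≡ z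
≢-≢⇒≡ x≢y y≢z = trans (¬-not x≢y) (sym (¬-not (λ z≡y → y≢z (sym z≡y))))

xor-≡⇒false : ∀ p {b} → p xor b ≡ b → p ≡ false
xor-≡⇒false false _    = refl
xor-≡⇒false true  nb≡b = ⊥-elim (not-¬ refl (sym nb≡b))

entry≤1 : IsAdjacency M → ∀ i j → M i j ≤ 1
entry≤1 isM i j with IsAdjacency.zero-one isM i j
... | inj₁ Mij≡0 rewrite Mij≡0 = z≤n
... | inj₂ Mij≡1 rewrite Mij≡1 = ≤-refl

Adj-sym : IsAdjacency M → Adj M i j → Adj M j i
Adj-sym {i = i} {j} isM e = trans (IsAdjacency.symmetric isM j i) e

Adj⇒≢ : IsAdjacency M → Adj M i j → i ≢ j
Adj⇒≢ {i = i} isM e refl = 0≢1+n (trans (sym (IsAdjacency.diag-zero isM i)) e)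

Adj⇒degree-nonZero : Adj M i j → NonZero (degree M i)
Adj⇒degree-nonZero {M = M} {i} {j} e =
  >-nonZero (subst (_≤ degree M i) e (subst (M i j ≤_) (sym (∑≗sum (M i))) (≤-sum (M i) j)))

_++_ : WalkIn M P i j → WalkIn M P j k → WalkIn M P i k
here _     ++ w′ = w′
step p e w ++ w′ = step p e (w ++ w′)

reverse : IsAdjacency M → WalkIn M All i j → WalkIn M All j i
reverse isM (here _)     = here tt
reverse isM (step _ e w) = reverse isM w ++ step tt (Adj-sym isM e) (here tt)

connected-from-hub : IsAdjacency M → {u : Fin n} → (∀ v → WalkIn M All u v) → Connected M
connected-from-hub isM reach i j = reverse isM (reach i) ++ reach j

connected-neighbour : Connected M → i ≢ j → ∃ (Adj M i)
connected-neighbour {i = i} {j} conn i≢j with conn i j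
... | here _       = ⊥-elim (i≢j refl)
... | step _ e _ = _ , e

disconnected⇒vertex : ∀ {n} {M : Mat n} → ¬ Connected M → Fin n
disconnected⇒vertex {zero}  ¬conn = ⊥-elim (¬conn (λ ()))
disconnected⇒vertex {suc n} ¬conn = zero

constant-along-walk : (f : Fin n → ℕ) → (∀ {i j} → Adj M i j → f i ≡ f j) →
                      WalkIn M P i j → f i ≡ f j
constant-along-walk f f-edge (here _)     = refl
constant-along-walk f f-edge (step _ e w) = trans (f-edge e) (constant-along-walk f f-edge w)

monochromatic-edge : ¬ Bipartite M → (c : Fin n → Bool) → ∃₂ λ u v → Adj M u v × c u ≡ c v
monochromatic-edge {M = M} ¬bip c
  with any? (λ u → any? (λ v → (M u v ≟ℕ 1) ×-dec (c u ≟ c v)))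
... | yes (u , v , e , same) = u , v , e , same
... | no none = ⊥-elim (¬bip (c , λ u v e same → none (u , v , e , same)))

-- Walks indexed by the parity of their length (true = odd). Indexing a cons by the parity of the
-- walk it builds lets an even walk be matched as e ∷ e′ ∷ w.
data Walk {n : ℕ} (M : Mat n) : Bool → Fin n → Fin n → Set where
  []  : Walk M false i i
  _∷_ : Adj M i j → Walk M (not p) j k → Walk M p i k

infixr 5 _∷_ _◅_

_◅_ : Adj M i j → Walk M p j k → Walk M (not p) i k
_◅_ {p = false} e w = e ∷ w
_◅_ {p = true}  e w = e ∷ w

_++ᵖ_ : Walk M p i j → Walk M q j k → Walk M (p xor q) i k
[] ++ᵖ w′ = w′
_++ᵖ_ {M = M} {q = q} (_∷_ {p = p} e w) w′ =
  e ∷ subst (λ r → Walk M r _ _) (sym (not-distribˡ-xor p q)) (w ++ᵖ w′)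

fromWalkIn : WalkIn M P i j → ∃ λ p → Walk M p i j
fromWalkIn (here _)     = false , []
fromWalkIn (step _ e w) with fromWalkIn w
... | p , w′ = not p , e ◅ w′

Closed : Mat n → (Fin n → Set) → Set
Closed M P = ∀ {i j} → P i → Adj M i j → P j

toWalkIn : Closed M P → P i → Walk M p i j → WalkIn M P i j
toWalkIn closed Pi []      = here Pi
toWalkIn closed Pi (e ∷ w) = step Pi e (toWalkIn closed (closed Pi e) w)

toWalkInAll : Walk M p i j → WalkIn M All i j
toWalkInAll = toWalkIn (λ _ _ → tt) tt

colour-parity : {d : Fin n → Bool} → Closed M P →
                (∀ i j → P i → P j → Adj M i j → d i ≢ d j) →
                P i → Walk M p i k → d k ≡ p xor d i
colour-parity closed d-proper Pi [] = refl
colour-parity {i = i} {d = d} closed d-proper Pi (_∷_ {j = j} {p = p} e w) = begin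
  _                   ≡⟨ colour-parity closed d-proper Pj w ⟩
  not p xor d j       ≡⟨ cong (not p xor_) (¬-not (λ dj≡di → d-proper i j Pi Pj e (sym dj≡di))) ⟩
  not p xor not (d i) ≡⟨ xor-annihilates-not p (d i) ⟩
  p xor d i           ∎
  where open ≡-Reasoning
        Pj = closed Pi e

same-colour⇒even : {c : Fin n → Bool} → (∀ i j → Adj M i j → c i ≢ c j) →
                   c i ≡ c k → Walk M p i k → p ≡ false
same-colour⇒even {p = p} c-proper same w =
  xor-≡⇒false p
    (trans (sym (colour-parity (λ _ _ → tt) (λ i j _ _ → c-proper i j) tt w)) (sym same))

even-of-opposite-parities : Walk M p i j → Walk M (not p) i j → Walk M false i j
even-of-opposite-parities {p = false} w _ = w
even-of-opposite-parities {p = true}  _ w = w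

even-walk-through-edge : ∀ {x u v y} → Walk M p x u → Walk M p x v → Adj M u v →
                         Walk M q v y → Walk M false x y
even-walk-through-edge {M = M} {p = p} {q = q} {x = x} {y = y} x⇝u x⇝v e v⇝y =
  even-of-opposite-parities (x⇝v ++ᵖ v⇝y)
    (subst (λ r → Walk M r x y) (sym (not-distribʳ-xor p q)) (x⇝u ++ᵖ (e ◅ v⇝y)))

-- Colour v by the parity of a walk from x to v; as M is not bipartite, some edge u v is
-- monochromatic, and the walks x ⇝ u and x ⇝ v then have equal parity.
even-walks-of-non-bipartite : Connected M → ¬ Bipartite M → ∀ x y → Walk M false x y
even-walks-of-non-bipartite {M = M} conn ¬bip x y
  with monochromatic-edge ¬bip (λ v → proj₁ (fromWalkIn (conn x v)))
... | u , v , e , same =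
  even-walk-through-edge (proj₂ (fromWalkIn (conn x u)))
    (subst (λ r → Walk M r x v) (sym same) (proj₂ (fromWalkIn (conn x v))))
    e (proj₂ (fromWalkIn (conn v y)))

*-reorder : ∀ a b c → a * (b * c) ≡ c * (b * a)
*-reorder = solve-∀

sandwich-symmetric : {R S : Mat n} → (∀ i j → R i j ≡ R j i) → (∀ i j → S i j ≡ S j i) →
                     ∀ i k → sum (λ j → R i j * sum (λ m → S j m * R m k))
                           ≡ sum (λ j → R k j * sum (λ m → S j m * R m i))
sandwich-symmetric {R = R} {S} R-sym S-sym i k = begin
  sum (λ j → R i j * sum (λ m → S j m * R m k))
    ≡⟨ sum-cong-≗ (λ j → *-distribˡ-sum (R i j) (λ m → S j m * R m k)) ⟩
  sum (λ j → sum (λ m → R i j * (S j m * R m k)))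
    ≡⟨ ∑-comm (λ j m → R i j * (S j m * R m k)) ⟩
  sum (λ m → sum (λ j → R i j * (S j m * R m k)))
    ≡⟨ sum-cong-≗ (λ m → sum-cong-≗ (λ j → mirror m j)) ⟩
  sum (λ m → sum (λ j → R k m * (S m j * R j i)))
    ≡⟨ sum-cong-≗ (λ m → *-distribˡ-sum (R k m) (λ j → S m j * R j i)) ⟨
  sum (λ m → R k m * sum (λ j → S m j * R j i))
    ∎
  where
  open ≡-Reasoning
  mirror : ∀ m j → R i j * (S j m * R m k) ≡ R k m * (S m j * R j i)
  mirror m j = trans (cong₂ _*_ (R-sym i j) (cong₂ _*_ (S-sym j m) (R-sym m k)))
                     (*-reorder (R j i) (S m j) (R k m))

indicator : Bool → ℕ
indicator true  = 1
indicator false = 0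

indicator-partition : ∀ b → indicator b + indicator (not b) ≡ 1
indicator-partition true  = refl
indicator-partition false = refl

degree-balance : IsAdjacency M → {c : Fin n → Bool} → (∀ i j → Adj M i j → c i ≢ c j) →
                 sum (λ i → indicator (c i) * degree M i)
                   ≡ sum (λ i → indicator (not (c i)) * degree M i)
degree-balance {M = M} isM {c} c-proper = begin
  sum (λ i → indicator (c i) * degree M i)
    ≡⟨ sum-cong-≗ (λ i → cong (indicator (c i) *_) (∑≗sum (M i))) ⟩
  sum (λ i → indicator (c i) * sum (M i))
    ≡⟨ sum-cong-≗ (λ i → *-distribˡ-sum (indicator (c i)) (M i)) ⟩
  sum (λ i → sum (λ j → indicator (c i) * M i j))
    ≡⟨ sum-cong-≗ (λ i → sum-cong-≗ (λ j → crossing i j)) ⟩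
  sum (λ i → sum (λ j → indicator (not (c j)) * M j i))
    ≡⟨ ∑-comm (λ i j → indicator (not (c j)) * M j i) ⟩
  sum (λ j → sum (λ i → indicator (not (c j)) * M j i))
    ≡⟨ sum-cong-≗ (λ j → *-distribˡ-sum (indicator (not (c j))) (M j)) ⟨
  sum (λ j → indicator (not (c j)) * sum (M j))
    ≡⟨ sum-cong-≗ (λ j → cong (indicator (not (c j)) *_) (∑≗sum (M j))) ⟨
  sum (λ j → indicator (not (c j)) * degree M j) ∎
  where
  open ≡-Reasoning
  crossing : ∀ i j → indicator (c i) * M i j ≡ indicator (not (c j)) * M j i
  crossing i j with IsAdjacency.zero-one isM i j | IsAdjacency.symmetric isM i j
  ... | inj₁ Mij≡0 | Mij≡Mji rewrite Mij≡0 | sym Mij≡Mji =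
    trans (*-zeroʳ (indicator (c i))) (sym (*-zeroʳ (indicator (not (c j)))))
  ... | inj₂ Mij≡1 | Mij≡Mji rewrite sym Mij≡Mji =
    cong (λ b → indicator b * M i j) (¬-not (c-proper i j Mij≡1))

regular-bipartite-even : IsAdjacency M → {c : Fin n → Bool} → (∀ i j → Adj M i j → c i ≢ c j) →
                         ∀ r .{{_ : NonZero r}} → (∀ i → degree M i ≡ r) → Even n
regular-bipartite-even {n = n} {M = M} isM {c} c-proper r regular = divides X (begin
  n                                                   ≡⟨ sum-ones ⟨
  sum {n} (λ _ → 1)
    ≡⟨ sum-cong-≗ (λ i → indicator-partition (c i)) ⟨
  sum (λ i → indicator (c i) + indicator (not (c i))) ≡⟨ ∑-distrib-+ (λ i → indicator (c i)) _ ⟩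
  X + Y                                               ≡⟨ cong (X +_) X≡Y ⟨
  X + X                                               ≡⟨ cong (X +_) (+-identityʳ X) ⟨
  2 * X                                               ≡⟨ *-comm 2 X ⟩
  X * 2                                               ∎)
  where
  open ≡-Reasoning
  X Y : ℕ
  X = sum (λ i → indicator (c i))
  Y = sum (λ i → indicator (not (c i)))
  X≡Y : X ≡ Y
  X≡Y = *-cancelʳ-≡ X Y r (begin
    X * r
      ≡⟨ *-distribʳ-sum r (λ i → indicator (c i)) ⟩
    sum (λ i → indicator (c i) * r)
      ≡⟨ sum-cong-≗ (λ i → cong (indicator (c i) *_) (regular i)) ⟨
    sum (λ i → indicator (c i) * degree M i)
      ≡⟨ degree-balance isM c-proper ⟩
    sum (λ i → indicator (not (c i)) * degree M i)
      ≡⟨ sum-cong-≗ (λ i → cong (indicator (not (c i)) *_) (regular i)) ⟩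
    sum (λ i → indicator (not (c i)) * r)
      ≡⟨ *-distribʳ-sum r (λ i → indicator (not (c i))) ⟨
    Y * r
      ∎)

module Factorisation {n : ℕ} {A B C : Mat n}
  (isA : IsAdjacency A) (isB : IsAdjacency B) (isC : IsAdjacency C)
  (A≡B·C : ∀ i j → A i j ≡ (B · C) i j) where

  A≡sum : ∀ i j → A i j ≡ sum (λ k → B i k * C k j)
  A≡sum i j = trans (A≡B·C i j) (∑≗sum (λ k → B i k * C k j))

  BC-edge : Adj B i k → Adj C k j → Adj A i j
  BC-edge {i} {k} {j} b c = ≤-antisym (entry≤1 isA i j) (begin
    1                             ≡⟨ cong₂ _*_ b c ⟨
    B i k * C k j                 ≤⟨ ≤-sum (λ m → B i m * C m j) k ⟩
    sum (λ m → B i m * C m j)     ≡⟨ A≡sum i j ⟨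
    A i j                         ∎)
    where open ≤-Reasoning

  CB-edge : Adj C i k → Adj B k j → Adj A i j
  CB-edge c b = Adj-sym isA (BC-edge (Adj-sym isB b) (Adj-sym isC c))

  CA-symmetric : ∀ i k → sum (λ j → C i j * A j k) ≡ sum (λ j → C k j * A j i)
  CA-symmetric i k = begin
    sum (λ j → C i j * A j k)
      ≡⟨ sum-cong-≗ (λ j → cong (C i j *_) (A≡sum j k)) ⟩
    sum (λ j → C i j * sum (λ m → B j m * C m k))
      ≡⟨ sandwich-symmetric (IsAdjacency.symmetric isC) (IsAdjacency.symmetric isB) i k ⟩
    sum (λ j → C k j * sum (λ m → B j m * C m i))
      ≡⟨ sum-cong-≗ (λ j → cong (C k j *_) (A≡sum j i)) ⟨
    sum (λ j → C k j * A j i)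
      ∎
    where open ≡-Reasoning

  degree-≤ : Adj B i k → degree C k ≤ degree C i
  degree-≤ {i} {k} b = begin
    degree C k                ≡⟨ ∑≗sum (C k) ⟩
    sum (C k)                 ≤⟨ sum-mono-≤ C-neighbour-is-A-neighbour ⟩
    sum (λ j → C k j * A j i) ≡⟨ CA-symmetric k i ⟩
    sum (λ j → C i j * A j k) ≤⟨ sum-mono-≤ (λ j → *-monoʳ-≤ (C i j) (entry≤1 isA j k)) ⟩
    sum (λ j → C i j * 1)     ≡⟨ sum-cong-≗ (λ j → *-identityʳ (C i j)) ⟩
    sum (C i)                 ≡⟨ ∑≗sum (C i) ⟨
    degree C i                ∎
    where
    open ≤-Reasoning
    C-neighbour-is-A-neighbour : ∀ j → C k j ≤ C k j * A j i
    C-neighbour-is-A-neighbour j with IsAdjacency.zero-one isC k j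
    ... | inj₁ Ckj≡0 rewrite Ckj≡0 = z≤n
    ... | inj₂ Ckj≡1 rewrite Ckj≡1 | Adj-sym isA (BC-edge b Ckj≡1) = ≤-refl

  lift-even : NoIsolatedVertex C → Walk B false i k → Walk A false i k
  lift-even no-isolated [] = []
  lift-even no-isolated (_∷_ {j = a} b (b′ ∷ w)) =
    BC-edge b c ∷ CB-edge (Adj-sym isC c) b′ ∷ lift-even no-isolated w
    where c = proj₂ (no-isolated a)

  module _ (B-connected : Connected B) (C-no-isolated : NoIsolatedVertex C) where

    A-connected : ¬ Bipartite B → Connected A
    A-connected ¬bip i j =
      toWalkInAll (lift-even C-no-isolated (even-walks-of-non-bipartite B-connected ¬bip i j))

    degree-C-constant : ∀ i j → degree C i ≡ degree C j
    degree-C-constant i j = constant-along-walk (degree C)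
      (λ b → ≤-antisym (degree-≤ (Adj-sym isB b)) (degree-≤ b)) (B-connected i j)

    A-neighbour : ∀ i → ∃ (Adj A i)
    A-neighbour i with C-no-isolated i
    ... | a , c with connected-neighbour B-connected (Adj⇒≢ isC (Adj-sym isC c))
    ... | j , b = j , CB-edge c b

    module Disconnected (c : Fin n → Bool) (c-proper : ∀ i j → Adj B i j → c i ≢ c j)
                        (A-disconnected : ¬ Connected A) where

      even-walk : c i ≡ c k → Walk A false i k
      even-walk {i} {k} same with fromWalkIn (B-connected i k)
      ... | p , w =
        lift-even C-no-isolated (subst (λ p → Walk B p i k) (same-colour⇒even c-proper same w) w)

      crossing-edge⇒connected : ∀ {u v} → Adj A u v → c u ≢ c v → Connected A
      crossing-edge⇒connected {u} {v} e u≢v = connected-from-hub isA reach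
        where
        reach : ∀ y → WalkIn A All u y
        reach y with c u ≟ c y
        ... | yes u≡y = toWalkInAll (even-walk u≡y)
        ... | no  u≢y = step tt e (toWalkInAll (even-walk (≢-≢⇒≡ (λ v≡u → u≢v (sym v≡u)) u≢y)))

      C-proper : ∀ i j → Adj C i j → c i ≢ c j
      C-proper i j e same with connected-neighbour B-connected (Adj⇒≢ isC e)
      ... | k , b = A-disconnected (crossing-edge⇒connected (BC-edge (Adj-sym isB b) e)
                      (λ k≡j → c-proper i k b (trans same (sym k≡j))))

      A-monochromatic : Adj A i j → c i ≡ c j
      A-monochromatic {i} {j} e =
        decidable-stable (c i ≟ c j) (λ i≢j → A-disconnected (crossing-edge⇒connected e i≢j))

      Class : Bool → Fin n → Set
      Class b i = c i ≡ b

      class-closed : ∀ b → Closed A (Class b)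
      class-closed b Pi e = trans (sym (A-monochromatic e)) Pi

      v₀ : Fin n
      v₀ = disconnected⇒vertex A-disconnected

      class-nonempty : ∀ b → ∃ (Class b)
      class-nonempty b with c v₀ ≟ b | C-no-isolated v₀
      ... | yes v₀∈b | _     = v₀ , v₀∈b
      ... | no  v₀∉b | a , e = a , ≢-≢⇒≡ (λ a≡v₀ → C-proper v₀ a e (sym a≡v₀)) v₀∉b

      class-connected : ∀ b → ConnectedOn A (Class b)
      class-connected b = class-nonempty b ,
        λ i j i∈b j∈b → toWalkIn (class-closed b) i∈b (even-walk (trans i∈b (sym j∈b)))

      class-non-bipartite : ∀ b → ¬ BipartiteOn A (Class b)
      class-non-bipartite b (d , d-proper) with class-nonempty b
      ... | x , x∈b with A-neighbour x
      ... | y , e = d-proper x y x∈b y∈b e (sym d-constant)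
        where
        y∈b : Class b y
        y∈b = class-closed b x∈b e
        d-constant : d y ≡ d x
        d-constant = colour-parity (class-closed b) d-proper x∈b (even-walk (A-monochromatic e))

      A-disjoint-union : DisjointUnionOfTwoConnNonBip A
      A-disjoint-union = c , (λ i j i≢j e → i≢j (A-monochromatic e))
                       , class-connected true  , class-non-bipartite true
                       , class-connected false , class-non-bipartite false

      C-regular : Regular C
      C-regular = degree C v₀ , λ i → degree-C-constant i v₀

      n-even : Even n
      n-even = regular-bipartite-even isC C-proper (degree C v₀)
                 {{Adj⇒degree-nonZero {M = C} (proj₂ (C-no-isolated v₀))}}
                 (λ i → degree-C-constant i v₀)

theorem6p6 : (n : ℕ) (A B C : Mat n) →
    IsAdjacency A → IsAdjacency B → IsAdjacency C →
    (∀ i j → A i j ≡ (B · C) i j) →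
    Connected B → NoIsolatedVertex C →
    ((¬ Bipartite B → Connected A)
     × (Bipartite B → ¬ Connected A →
          (Regular C × Bipartite C) × Even n × DisjointUnionOfTwoConnNonBip A))
theorem6p6 n A B C isA isB isC A≡B·C B-connected C-no-isolated =
  A-connected B-connected C-no-isolated , λ where
    (c , c-proper) A-disconnected →
      let open Disconnected B-connected C-no-isolated c c-proper A-disconnected
      in (C-regular , c , C-proper) , n-even , A-disjoint-union
  where open Factorisation isA isB isC A≡B·C
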